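{- Let $K=\mathbb Q(\zeta_5)\subseteq\mathbb C$ with $\zeta_5=\exp(2\pi i/5)$, let $\mathcal O_K$ be its ring of integers, and let $\sigma:K\hookrightarrow\mathbb C$ be the embedding with $\sigma(\zeta_5)=\zeta_5^2$; write $z^{\sigma}=\sigma(z)$. Let $\mathcal S=\{z\in\mathcal O_K : |z^{\sigma}|\leq 1\}$. Then for every $z\in\mathcal S$, the minimum $\min_{z'\in\mathcal S\setminus\{z\}}|z'-z|$ exists and belongs to $\left\{\frac{\sqrt5-1}{2},\,1\right\}$.
   Context: Elements of $K$ are regarded as complex numbers via the inclusion $K\subseteq\mathbb C$, and $|\cdot|$ is the complex absolute value. -}

module Defs where

open import Data.Integer using (ℤ; +_; -_; _+_; _-_; _*_; _≤_)
open import Data.Product using (_×_)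
open import Data.Sum using (_⊎_)
open import Relation.Binary.PropositionalEquality using (_≡_)

-- O_K = ℤ[ζ₅] (the ring of integers of ℚ(ζ₅)), with ℤ-basis 1, ζ, ζ², ζ³.
-- ⟨ a0 , a1 , a2 , a3 ⟩ stands for a0 + a1 ζ + a2 ζ² + a3 ζ³, where ζ = exp(2πi/5)
-- and ζ⁴ = -1 - ζ - ζ² - ζ³.  The representation is unique.
record OK : Set where
  constructor ⟨_,_,_,_⟩
  field
    a0 a1 a2 a3 : ℤ
open OK public

reduce : ℤ → ℤ → ℤ → ℤ → ℤ → OK
reduce c0 c1 c2 c3 c4 = ⟨ c0 - c4 , c1 - c4 , c2 - c4 , c3 - c4 ⟩

_-ᴷ_ : OK → OK → OK
⟨ a , b , c , d ⟩ -ᴷ ⟨ a' , b' , c' , d' ⟩ = ⟨ a - a' , b - b' , c - c' , d - d' ⟩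

-- multiplication (ζ⁵ = 1: cyclic convolution, then reduce)
_*ᴷ_ : OK → OK → OK
⟨ a0 , a1 , a2 , a3 ⟩ *ᴷ ⟨ b0 , b1 , b2 , b3 ⟩ =
  reduce (a0 * b0 + a2 * b3 + a3 * b2)
         (a0 * b1 + a1 * b0 + a3 * b3)
         (a0 * b2 + a1 * b1 + a2 * b0)
         (a0 * b3 + a1 * b2 + a2 * b1 + a3 * b0)
         (a1 * b3 + a2 * b2 + a3 * b1)

-- complex conjugation: ζᵏ ↦ ζ⁻ᵏ
conj : OK → OK
conj ⟨ a0 , a1 , a2 , a3 ⟩ = reduce a0 (+ 0) a3 a2 a1

-- the embedding σ with σ(ζ) = ζ²: ζ ↦ ζ², ζ² ↦ ζ⁴, ζ³ ↦ ζ⁶ = ζ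
σ : OK → OK
σ ⟨ a0 , a1 , a2 , a3 ⟩ = reduce a0 a3 a1 (+ 0) a2

-- Real numbers of the form (x + y √5)/4 with x y ∈ ℤ, represented by the pair (x , y).
record ℝ5 : Set where
  constructor _⊹_√5
  field
    x y : ℤ

-- 4 · Re(z) as an element of ℤ + ℤ√5, using
-- Re ζ = (√5 - 1)/4, Re ζ² = Re ζ³ = (-√5 - 1)/4.
-- Re z is returned as (x ⊹ y √5) meaning (x + y√5)/4.
Re : OK → ℝ5
Re ⟨ a0 , a1 , a2 , a3 ⟩ =
  ((+ 4) * a0 - a1 - a2 - a3) ⊹ (a1 - a2 - a3) √5

-- |z|² = z · conj z (a real number, equal to its real part), as (x + y√5)/4
absSq : OK → ℝ5
absSq z = Re (z *ᴷ conj z)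

NonNeg√5 : ℤ → ℤ → Set
NonNeg√5 x y =
    ((+ 0) ≤ x × (+ 0) ≤ y)
  ⊎ (((+ 0) ≤ x × y ≤ (+ 0)) × ((+ 5) * (y * y) ≤ x * x))
  ⊎ ((x ≤ (+ 0) × (+ 0) ≤ y) × (x * x ≤ (+ 5) * (y * y)))

_≤ᴿ_ : ℝ5 → ℝ5 → Set
(x ⊹ y √5) ≤ᴿ (x' ⊹ y' √5) = NonNeg√5 (x' - x) (y' - y)

-- 1 = (4 + 0√5)/4
oneᴿ : ℝ5
oneᴿ = (+ 4) ⊹ (+ 0) √5

-- ((√5 - 1)/2)² = (3 - √5)/2 = (6 - 2√5)/4
goldSqᴿ : ℝ5
goldSqᴿ = (+ 6) ⊹ (- (+ 2)) √5

InS : OK → Set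
InS z = absSq (σ z) ≤ᴿ oneᴿ

distSq : OK → OK → ℝ5
distSq z z' = absSq (z' -ᴷ z)

{-# OPTIONS --safe #-}
-- Write A(v) for 4|v|², an element of ℤ[√5].  Since σ restricts to the Galois
-- conjugation √5 ↦ -√5 of ℚ(√5), A(v^σ) is the conjugate of A(v): membership in 𝒮
-- and all distances become statements in the ordered ring ℤ[√5] ⊂ ℝ, which reduce
-- to integer arithmetic.
--
-- Distance 1 is always attained: if none of z ± ζᵏ (k < 5) lay in 𝒮, then with
-- w = z^σ the five products (|w + ζᵏ|² - 1)(|w - ζᵏ|² - 1) = |w|⁴ - 4 Re(w ζ⁻ᵏ)²
-- would all be positive.  But Σₖ Re(w ζ⁻ᵏ)² = 5/2 |w|², so their sum is
-- 5 |w|² (|w|² - 2) ≤ 0.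
--
-- Nothing closer than (√5 - 1)/2 occurs: for distinct z, w ∈ 𝒮 the parallelogram
-- law gives |(w - z)^σ| ≤ 2, so |w - z| < 1 bounds the trace of |w - z|² and hence
-- the coordinates of w - z in the basis 1, ζ, ζ², ζ³ by 3.  A finite check over that
-- box shows that w - z is then one of ten elements of absolute value (√5 - 1)/2.
module Submission where

open import Defs
open import Data.Empty using (⊥; ⊥-elim)
open import Data.Integer using (ℤ; +_; -_; -[1+_]; _+_; _-_; _*_; _≤_; 0ℤ; 1ℤ; +≤+)
open import Data.Integer.Properties
  using (_≟_; _≤?_; ≤-trans; +-mono-≤; *-monoˡ-≤-nonNeg; *-zeroʳ; ≰⇒>; neg-mono-<; i<j⇒suc[i]≤j;
         i≤j⇒0≤j-i; 0≤i-j⇒j≤i; i-j≡0⇒i≡j)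
open import Data.Integer.Tactic.RingSolver using (solve-∀)
open import Data.List using (List; []; _∷_; map; length)
open import Data.List.Membership.Propositional using (_∈_; lose)
open import Data.List.Relation.Unary.All using (All; []; _∷_; all?; lookup; lookupAny)
import Data.List.Relation.Unary.All as All
open import Data.List.Relation.Unary.All.Properties using (¬Any⇒All¬)
open import Data.List.Relation.Unary.Any using (Any; here; there; any?)
import Data.List.Relation.Unary.Any as Any
open import Data.Nat using (suc; z≤n; s≤s)
open import Data.Product using (Σ; _×_; _,_)
open import Data.Sum using (_⊎_; inj₁; inj₂; [_,_]′)
open import Function using (id)
open import Relation.Binary.Definitions using (DecidableEquality)
open import Relation.Binary.PropositionalEquality using (_≡_; _≢_; refl; sym; trans; subst; subst₂; cong; cong₂)
open import Relation.Nullary using (¬_; Dec; yes; no; ¬?)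
open import Relation.Nullary.Decidable using (_⊎-dec_; _×-dec_; map′; toWitness)

-- Facts over ℤ are kept in the shape 0ℤ ≤ e or 1ℤ ≤ e, so that they can be moved
-- along ring identities with subst.

0≤-+ : ∀ {a b} → 0ℤ ≤ a → 0ℤ ≤ b → 0ℤ ≤ a + b
0≤-+ = +-mono-≤

1≤-+ : ∀ {a b} → 1ℤ ≤ a → 0ℤ ≤ b → 1ℤ ≤ a + b
1≤-+ = +-mono-≤

0≤-* : ∀ {a b} → 0ℤ ≤ a → 0ℤ ≤ b → 0ℤ ≤ a * b
0≤-* {+ m} {b} _ hb = subst (_≤ + m * b) (*-zeroʳ (+ m)) (*-monoˡ-≤-nonNeg (+ m) hb)

0≤1 : 0ℤ ≤ 1ℤ
0≤1 = +≤+ z≤n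

0≤5 : 0ℤ ≤ + 5
0≤5 = +≤+ z≤n

1≤⇒0≤ : ∀ {a} → 1ℤ ≤ a → 0ℤ ≤ a
1≤⇒0≤ = ≤-trans 0≤1

1≰0 : ∀ {e} → 1ℤ ≤ e → e ≡ 0ℤ → ⊥
1≰0 (+≤+ ()) refl

0≤-neg : ∀ {a} → a ≤ 0ℤ → 0ℤ ≤ - a
0≤-neg {a} h = subst (0ℤ ≤_) (e a) (i≤j⇒0≤j-i h)
  where
  e : ∀ a → 0ℤ - a ≡ - a
  e = solve-∀

≤0-neg : ∀ {a} → 0ℤ ≤ - a → a ≤ 0ℤ
≤0-neg {a} h = 0≤i-j⇒j≤i (subst (0ℤ ≤_) (e a) h)
  where
  e : ∀ a → - a ≡ 0ℤ - a
  e = solve-∀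

sign : ∀ a → 0ℤ ≤ a ⊎ 1ℤ ≤ - a
sign a with 0ℤ ≤? a
... | yes h = inj₁ h
... | no h  = inj₂ (i<j⇒suc[i]≤j (neg-mono-< (≰⇒> h)))

sign′ : ∀ a → 1ℤ ≤ a ⊎ 0ℤ ≤ - a
sign′ a with sign (- a)
... | inj₁ h = inj₂ h
... | inj₂ h = inj₁ (subst (1ℤ ≤_) (e a) h)
  where
  e : ∀ a → - - a ≡ a
  e = solve-∀

0≤-square : ∀ a → 0ℤ ≤ a * a
0≤-square a with sign a
... | inj₁ h = 0≤-* h h
... | inj₂ h = subst (0ℤ ≤_) (e a) (0≤-* (1≤⇒0≤ h) (1≤⇒0≤ h))
  where
  e : ∀ a → - a * - a ≡ a * a
  e = solve-∀

1≤-* : ∀ {a b} → 1ℤ ≤ a → 1ℤ ≤ b → 1ℤ ≤ a * b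
1≤-* {a} {b} ha hb = subst (1ℤ ≤_) (e a b) (1≤-+ hb (0≤-* (i≤j⇒0≤j-i ha) (1≤⇒0≤ hb)))
  where
  e : ∀ a b → b + (a - 1ℤ) * b ≡ a * b
  e = solve-∀

1≤-cancel : ∀ {k a} → 1ℤ ≤ k → 0ℤ ≤ k * a → 0ℤ ≤ a
1≤-cancel {k} {a} hk h with sign a
... | inj₁ ha = ha
... | inj₂ ha = ⊥-elim (1≰0 (1≤-+ (1≤-* hk ha) h) (e k a))
  where
  e : ∀ k a → k * - a + k * a ≡ 0ℤ
  e = solve-∀

√-mono : ∀ {u v} → 0ℤ ≤ u → 0ℤ ≤ v → 0ℤ ≤ v * v - u * u → 0ℤ ≤ v - u
√-mono {u} {v} hu hv h with sign (v - u)
... | inj₁ r = r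
... | inj₂ r = ⊥-elim (1≰0 (1≤-+ (1≤-* r (1≤-+ r (0≤-+ hv hv))) h) (e u v))
  where
  e : ∀ u v → - (v - u) * (- (v - u) + (v + v)) + (v * v - u * u) ≡ 0ℤ
  e = solve-∀

-- Read 0ℤ ≤ n * (q * q) - m * (p * p) as p √m ≤ q √n: such inequalities between
-- nonnegative quantities can be multiplied and added.
module _ {m n p q r s : ℤ} (hm : 0ℤ ≤ m) (hn : 0ℤ ≤ n) (hp : 0ℤ ≤ p) (hq : 0ℤ ≤ q) (hr : 0ℤ ≤ r) (hs : 0ℤ ≤ s) where

  scaled-*-mono : 0ℤ ≤ n * (q * q) - m * (p * p) → 0ℤ ≤ n * (s * s) - m * (r * r) →
                  0ℤ ≤ n * (q * s) - m * (p * r)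
  scaled-*-mono h₁ h₂ =
    √-mono (0≤-* hm (0≤-* hp hr)) (0≤-* hn (0≤-* hq hs))
      (subst (0ℤ ≤_) (e m n p q r s) (0≤-+ (0≤-* h₁ (0≤-* hn (0≤-square s))) (0≤-* (0≤-* hm (0≤-square p)) h₂)))
    where
    e : ∀ m n p q r s → (n * (q * q) - m * (p * p)) * (n * (s * s)) + m * (p * p) * (n * (s * s) - m * (r * r))
          ≡ n * (q * s) * (n * (q * s)) - m * (p * r) * (m * (p * r))
    e = solve-∀

  scaled-+-mono : 0ℤ ≤ n * (q * q) - m * (p * p) → 0ℤ ≤ n * (s * s) - m * (r * r) →
                  0ℤ ≤ n * ((q + s) * (q + s)) - m * ((p + r) * (p + r))
  scaled-+-mono h₁ h₂ = subst (0ℤ ≤_) (e m n p q r s) (0≤-+ (0≤-+ h₁ h₂) (0≤-+ c c))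
    where
    c = scaled-*-mono h₁ h₂
    e : ∀ m n p q r s → (n * (q * q) - m * (p * p)) + (n * (s * s) - m * (r * r)) + ((n * (q * s) - m * (p * r)) + (n * (q * s) - m * (p * r)))
          ≡ n * ((q + s) * (q + s)) - m * ((p + r) * (p + r))
    e = solve-∀

  scaled-+-mono-< : 1ℤ ≤ n * (q * q) - m * (p * p) → 0ℤ ≤ n * (s * s) - m * (r * r) →
                    1ℤ ≤ n * ((q + s) * (q + s)) - m * ((p + r) * (p + r))
  scaled-+-mono-< h₁ h₂ = subst (1ℤ ≤_) (e m n p q r s) (1≤-+ h₁ (0≤-+ h₂ (0≤-+ c c)))
    where
    c = scaled-*-mono (1≤⇒0≤ h₁) h₂
    e : ∀ m n p q r s → (n * (q * q) - m * (p * p)) + ((n * (s * s) - m * (r * r)) + ((n * (q * s) - m * (p * r)) + (n * (q * s) - m * (p * r))))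
          ≡ n * ((q + s) * (q + s)) - m * ((p + r) * (p + r))
    e = solve-∀

-- ℝ5 as the ring ℤ[√5], x ⊹ y √5 standing for x + y √5.  Defs reads it as
-- (x + y √5)/4, so absSq v is 4|v|² here, oneᴿ is 4 and goldSqᴿ is 4 ((√5 - 1)/2)².

infixl 6 _⊕_ _⊖_
infixl 7 _⊗_ _⊙_

_⊕_ _⊖_ _⊗_ : ℝ5 → ℝ5 → ℝ5
(a ⊹ b √5) ⊕ (c ⊹ d √5) = (a + c) ⊹ (b + d) √5
(a ⊹ b √5) ⊖ (c ⊹ d √5) = (a - c) ⊹ (b - d) √5
(a ⊹ b √5) ⊗ (c ⊹ d √5) = (a * c + + 5 * (b * d)) ⊹ (a * d + b * c) √5

⊖_ : ℝ5 → ℝ5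
⊖ (a ⊹ b √5) = (- a) ⊹ (- b) √5

_⊙_ : ℤ → ℝ5 → ℝ5
k ⊙ (a ⊹ b √5) = (k * a) ⊹ (k * b) √5

√5⊗_ : ℝ5 → ℝ5
√5⊗ (a ⊹ b √5) = (+ 5 * b) ⊹ a √5

≡-⊹ : ∀ {a b c d} → a ≡ c → b ≡ d → a ⊹ b √5 ≡ c ⊹ d √5
≡-⊹ = cong₂ _⊹_√5

NonNeg : ℝ5 → Set
NonNeg (a ⊹ b √5) = NonNeg√5 a b

Pos : ℝ5 → Set
Pos u = ¬ NonNeg (⊖ u)

data Shape (x y : ℤ) : Set where
  both-nonNeg      : 0ℤ ≤ x → 0ℤ ≤ y → Shape x y
  rational-major   : 0ℤ ≤ x → 0ℤ ≤ - y → 0ℤ ≤ x * x - + 5 * (y * y) → Shape x y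
  irrational-major : 0ℤ ≤ - x → 0ℤ ≤ y → 0ℤ ≤ + 5 * (y * y) - x * x → Shape x y

shape : ∀ {x y} → NonNeg√5 x y → Shape x y
shape (inj₁ (hx , hy))                = both-nonNeg hx hy
shape (inj₂ (inj₁ ((hx , hy) , h)))   = rational-major hx (0≤-neg hy) (i≤j⇒0≤j-i h)
shape (inj₂ (inj₂ ((hx , hy) , h)))   = irrational-major (0≤-neg hx) hy (i≤j⇒0≤j-i h)

unshape : ∀ {x y} → Shape x y → NonNeg√5 x y
unshape (both-nonNeg hx hy)         = inj₁ (hx , hy)
unshape (rational-major hx hy h)    = inj₂ (inj₁ ((hx , ≤0-neg hy) , 0≤i-j⇒j≤i h))
unshape (irrational-major hx hy h)  = inj₂ (inj₂ ((≤0-neg hx , hy) , 0≤i-j⇒j≤i h))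

nonNeg-+ˣ : ∀ {x y k} → 0ℤ ≤ k → NonNeg√5 x y → NonNeg√5 (x + k) y
nonNeg-+ˣ {x} {y} {k} hk h with shape h
... | both-nonNeg hx hy = unshape (both-nonNeg (0≤-+ hx hk) hy)
... | rational-major hx hy h₂ =
  unshape (rational-major (0≤-+ hx hk) hy
    (subst (0ℤ ≤_) (e x y k) (0≤-+ h₂ (0≤-* hk (0≤-+ (0≤-+ hx hx) hk)))))
  where
  e : ∀ x y k → x * x - + 5 * (y * y) + k * (x + x + k) ≡ (x + k) * (x + k) - + 5 * (y * y)
  e = solve-∀
... | irrational-major hx hy h₂ with sign (x + k)
...   | inj₁ r = unshape (both-nonNeg r hy)
...   | inj₂ r = unshape (irrational-major (1≤⇒0≤ r) hy
                   (subst (0ℤ ≤_) (e x y k) (0≤-+ h₂ (0≤-* hk (0≤-+ hx (1≤⇒0≤ r))))))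
  where
  e : ∀ x y k → + 5 * (y * y) - x * x + k * (- x + - (x + k)) ≡ + 5 * (y * y) - (x + k) * (x + k)
  e = solve-∀

nonNeg-+ʸ : ∀ {x y k} → 0ℤ ≤ k → NonNeg√5 x y → NonNeg√5 x (y + k)
nonNeg-+ʸ {x} {y} {k} hk h with shape h
... | both-nonNeg hx hy = unshape (both-nonNeg hx (0≤-+ hy hk))
... | irrational-major hx hy h₂ =
  unshape (irrational-major hx (0≤-+ hy hk)
    (subst (0ℤ ≤_) (e x y k) (0≤-+ h₂ (0≤-* 0≤5 (0≤-* hk (0≤-+ (0≤-+ hy hy) hk))))))
  where
  e : ∀ x y k → + 5 * (y * y) - x * x + + 5 * (k * (y + y + k)) ≡ + 5 * ((y + k) * (y + k)) - x * x
  e = solve-∀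
... | rational-major hx hy h₂ with sign (y + k)
...   | inj₁ r = unshape (both-nonNeg hx r)
...   | inj₂ r = unshape (rational-major hx (1≤⇒0≤ r)
                   (subst (0ℤ ≤_) (e x y k) (0≤-+ h₂ (0≤-* 0≤5 (0≤-* hk (0≤-+ hy (1≤⇒0≤ r)))))))
  where
  e : ∀ x y k → x * x - + 5 * (y * y) + + 5 * (k * (- y + - (y + k))) ≡ x * x - + 5 * ((y + k) * (y + k))
  e = solve-∀

-- Adds a + b √5 ≥ 0 (rational part dominant) to c + d √5 ≥ 0 (irrational part dominant);
-- s, t and N stand for a + c, b + d and ±(s² - 5 t²).  If the sum has the wrong shape,
-- adding one summand's inequality to the negated claim contradicts the other summand.
nonNeg-+-mixed : ∀ {a b c d} → 0ℤ ≤ a → 0ℤ ≤ - b → 0ℤ ≤ a * a - + 5 * (b * b) →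
                 0ℤ ≤ - c → 0ℤ ≤ d → 0ℤ ≤ + 5 * (d * d) - c * c → NonNeg√5 (a + c) (b + d)
nonNeg-+-mixed {a} {b} {c} {d} ha hb h₁ hc hd h₂ with sign (a + c) | sign (b + d)
... | inj₁ s≥0 | inj₁ t≥0 = unshape (both-nonNeg s≥0 t≥0)
... | inj₁ s≥0 | inj₂ -t≥1 with sign ((a + c) * (a + c) - + 5 * ((b + d) * (b + d)))
...   | inj₁ N≥0 = unshape (rational-major s≥0 (1≤⇒0≤ -t≥1) N≥0)
...   | inj₂ -N≥1 = ⊥-elim (1≰0 (1≤-+ too-big h₁) (e₃ a b c d))
  where
  too-big = scaled-+-mono-< 0≤1 0≤5 s≥0 (1≤⇒0≤ -t≥1) hc hd
              (subst (1ℤ ≤_) (e₁ a b c d) -N≥1) (subst (0ℤ ≤_) (e₂ c d) h₂)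
    where
    e₁ : ∀ a b c d → - ((a + c) * (a + c) - + 5 * ((b + d) * (b + d))) ≡ + 5 * (- (b + d) * - (b + d)) - + 1 * ((a + c) * (a + c))
    e₁ = solve-∀
    e₂ : ∀ c d → + 5 * (d * d) - c * c ≡ + 5 * (d * d) - + 1 * (- c * - c)
    e₂ = solve-∀
  e₃ : ∀ a b c d → + 5 * ((- (b + d) + d) * (- (b + d) + d)) - + 1 * ((a + c + - c) * (a + c + - c)) + (a * a - + 5 * (b * b)) ≡ 0ℤ
  e₃ = solve-∀
nonNeg-+-mixed {a} {b} {c} {d} ha hb h₁ hc hd h₂ | inj₂ -s≥1 | inj₁ t≥0 with sign (+ 5 * ((b + d) * (b + d)) - (a + c) * (a + c))
...   | inj₁ N≥0 = unshape (irrational-major (1≤⇒0≤ -s≥1) t≥0 N≥0)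
...   | inj₂ -N≥1 = ⊥-elim (1≰0 (1≤-+ too-big h₂) (e₃ a b c d))
  where
  too-big = scaled-+-mono-< 0≤5 0≤1 t≥0 (1≤⇒0≤ -s≥1) hb ha
              (subst (1ℤ ≤_) (e₁ a b c d) -N≥1) (subst (0ℤ ≤_) (e₂ a b) h₁)
    where
    e₁ : ∀ a b c d → - (+ 5 * ((b + d) * (b + d)) - (a + c) * (a + c)) ≡ + 1 * (- (a + c) * - (a + c)) - + 5 * ((b + d) * (b + d))
    e₁ = solve-∀
    e₂ : ∀ a b → a * a - + 5 * (b * b) ≡ + 1 * (a * a) - + 5 * (- b * - b)
    e₂ = solve-∀
  e₃ : ∀ a b c d → + 1 * ((- (a + c) + a) * (- (a + c) + a)) - + 5 * ((b + d + - b) * (b + d + - b)) + (+ 5 * (d * d) - c * c) ≡ 0ℤ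
  e₃ = solve-∀
nonNeg-+-mixed {a} {b} {c} {d} ha hb h₁ hc hd h₂ | inj₂ -s≥1 | inj₂ -t≥1 =
  ⊥-elim (1≰0 (1≤-+ c²-a² (0≤-+ (0≤-+ h₁ h₂) (0≤-* 0≤5 b²-d²))) (e a b c d))
  where
  c²-a² = 1≤-* (subst (1ℤ ≤_) (e₁ a c) -s≥1) (subst (1ℤ ≤_) (e₂ a c) (1≤-+ -s≥1 (0≤-+ ha ha)))
    where
    e₁ : ∀ a c → - (a + c) ≡ - c - a
    e₁ = solve-∀
    e₂ : ∀ a c → - (a + c) + (a + a) ≡ - c + a
    e₂ = solve-∀
  b²-d² = 0≤-* (1≤⇒0≤ -t≥1) (0≤-+ hb hd)
  e : ∀ a b c d → (- c - a) * (- c + a) + ((a * a - + 5 * (b * b) + (+ 5 * (d * d) - c * c)) + + 5 * (- (b + d) * (- b + d))) ≡ 0ℤ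
  e = solve-∀

nonNeg-⊕ : ∀ {u v} → NonNeg u → NonNeg v → NonNeg (u ⊕ v)
nonNeg-⊕ {a ⊹ b √5} {c ⊹ d √5} hu hv with shape hu | shape hv
... | both-nonNeg ha hb | _ = subst₂ NonNeg√5 (e c a) (e d b) (nonNeg-+ʸ hb (nonNeg-+ˣ ha hv))
  where
  e : ∀ c a → c + a ≡ a + c
  e = solve-∀
... | _ | both-nonNeg hc hd = nonNeg-+ʸ hd (nonNeg-+ˣ hc hu)
... | rational-major ha hb h₁ | rational-major hc hd h₂ =
  unshape (rational-major (0≤-+ ha hc) (subst (0ℤ ≤_) (e₀ b d) (0≤-+ hb hd))
    (subst (0ℤ ≤_) (e₂ a b c d)
      (scaled-+-mono 0≤5 0≤1 hb ha hd hc (subst (0ℤ ≤_) (e₁ a b) h₁) (subst (0ℤ ≤_) (e₁ c d) h₂))))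
  where
  e₀ : ∀ b d → - b + - d ≡ - (b + d)
  e₀ = solve-∀
  e₁ : ∀ a b → a * a - + 5 * (b * b) ≡ + 1 * (a * a) - + 5 * (- b * - b)
  e₁ = solve-∀
  e₂ : ∀ a b c d → + 1 * ((a + c) * (a + c)) - + 5 * ((- b + - d) * (- b + - d)) ≡ (a + c) * (a + c) - + 5 * ((b + d) * (b + d))
  e₂ = solve-∀
... | irrational-major ha hb h₁ | irrational-major hc hd h₂ =
  unshape (irrational-major (subst (0ℤ ≤_) (e₀ a c) (0≤-+ ha hc)) (0≤-+ hb hd)
    (subst (0ℤ ≤_) (e₂ a b c d)
      (scaled-+-mono 0≤1 0≤5 ha hb hc hd (subst (0ℤ ≤_) (e₁ a b) h₁) (subst (0ℤ ≤_) (e₁ c d) h₂))))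
  where
  e₀ : ∀ a c → - a + - c ≡ - (a + c)
  e₀ = solve-∀
  e₁ : ∀ a b → + 5 * (b * b) - a * a ≡ + 5 * (b * b) - + 1 * (- a * - a)
  e₁ = solve-∀
  e₂ : ∀ a b c d → + 5 * ((b + d) * (b + d)) - + 1 * ((- a + - c) * (- a + - c)) ≡ + 5 * ((b + d) * (b + d)) - (a + c) * (a + c)
  e₂ = solve-∀
... | rational-major ha hb h₁ | irrational-major hc hd h₂ = nonNeg-+-mixed ha hb h₁ hc hd h₂
... | irrational-major ha hb h₁ | rational-major hc hd h₂ =
  subst₂ NonNeg√5 (e c a) (e d b) (nonNeg-+-mixed hc hd h₂ ha hb h₁)
  where
  e : ∀ c a → c + a ≡ a + c
  e = solve-∀

nonNeg-⊙ : ∀ {k u} → 0ℤ ≤ k → NonNeg u → NonNeg (k ⊙ u)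
nonNeg-⊙ {k} {x ⊹ y √5} hk h with shape h
... | both-nonNeg hx hy = unshape (both-nonNeg (0≤-* hk hx) (0≤-* hk hy))
... | rational-major hx hy h₂ =
  unshape (rational-major (0≤-* hk hx) (subst (0ℤ ≤_) (e₁ k y) (0≤-* hk hy))
    (subst (0ℤ ≤_) (e₂ k x y) (0≤-* (0≤-square k) h₂)))
  where
  e₁ : ∀ k y → k * - y ≡ - (k * y)
  e₁ = solve-∀
  e₂ : ∀ k x y → k * k * (x * x - + 5 * (y * y)) ≡ k * x * (k * x) - + 5 * (k * y * (k * y))
  e₂ = solve-∀
... | irrational-major hx hy h₂ =
  unshape (irrational-major (subst (0ℤ ≤_) (e₁ k x) (0≤-* hk hx)) (0≤-* hk hy)
    (subst (0ℤ ≤_) (e₂ k x y) (0≤-* (0≤-square k) h₂)))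
  where
  e₁ : ∀ k x → k * - x ≡ - (k * x)
  e₁ = solve-∀
  e₂ : ∀ k x y → k * k * (+ 5 * (y * y) - x * x) ≡ + 5 * (k * y * (k * y)) - k * x * (k * x)
  e₂ = solve-∀

nonNeg-⊙⁻¹ : ∀ {k u} → 1ℤ ≤ k → NonNeg (k ⊙ u) → NonNeg u
nonNeg-⊙⁻¹ {k} {x ⊹ y √5} hk h with shape h
... | both-nonNeg hx hy = unshape (both-nonNeg (1≤-cancel hk hx) (1≤-cancel hk hy))
... | rational-major hx hy h₂ =
  unshape (rational-major (1≤-cancel hk hx) (1≤-cancel hk (subst (0ℤ ≤_) (e₁ k y) hy))
    (1≤-cancel (1≤-* hk hk) (subst (0ℤ ≤_) (e₂ k x y) h₂)))
  where
  e₁ : ∀ k y → - (k * y) ≡ k * - y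
  e₁ = solve-∀
  e₂ : ∀ k x y → k * x * (k * x) - + 5 * (k * y * (k * y)) ≡ k * k * (x * x - + 5 * (y * y))
  e₂ = solve-∀
... | irrational-major hx hy h₂ =
  unshape (irrational-major (1≤-cancel hk (subst (0ℤ ≤_) (e₁ k x) hx)) (1≤-cancel hk hy)
    (1≤-cancel (1≤-* hk hk) (subst (0ℤ ≤_) (e₂ k x y) h₂)))
  where
  e₁ : ∀ k x → - (k * x) ≡ k * - x
  e₁ = solve-∀
  e₂ : ∀ k x y → + 5 * (k * y * (k * y)) - k * x * (k * x) ≡ k * k * (+ 5 * (y * y) - x * x)
  e₂ = solve-∀

nonNeg-√5⊗ : ∀ {u} → NonNeg u → NonNeg (√5⊗ u)
nonNeg-√5⊗ {x ⊹ y √5} h with shape h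
... | both-nonNeg hx hy = unshape (both-nonNeg (0≤-* 0≤5 hy) hx)
... | rational-major hx hy h₂ =
  unshape (irrational-major (subst (0ℤ ≤_) (e₁ y) (0≤-* 0≤5 hy)) hx (subst (0ℤ ≤_) (e₂ x y) (0≤-* 0≤5 h₂)))
  where
  e₁ : ∀ y → + 5 * - y ≡ - (+ 5 * y)
  e₁ = solve-∀
  e₂ : ∀ x y → + 5 * (x * x - + 5 * (y * y)) ≡ + 5 * (x * x) - + 5 * y * (+ 5 * y)
  e₂ = solve-∀
... | irrational-major hx hy h₂ =
  unshape (rational-major (0≤-* 0≤5 hy) hx (subst (0ℤ ≤_) (e₂ x y) (0≤-* 0≤5 h₂)))
  where
  e₂ : ∀ x y → + 5 * (+ 5 * (y * y) - x * x) ≡ + 5 * y * (+ 5 * y) - + 5 * (x * x)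
  e₂ = solve-∀

nonNeg-total : ∀ u → ¬ NonNeg u → NonNeg (⊖ u)
nonNeg-total (x ⊹ y √5) ¬h with sign x | sign y
... | inj₁ hx | inj₁ hy = ⊥-elim (¬h (unshape (both-nonNeg hx hy)))
... | inj₂ hx | inj₂ hy = unshape (both-nonNeg (1≤⇒0≤ hx) (1≤⇒0≤ hy))
... | inj₁ hx | inj₂ hy with sign (x * x - + 5 * (y * y))
...   | inj₁ t = ⊥-elim (¬h (unshape (rational-major hx (1≤⇒0≤ hy) t)))
...   | inj₂ t = unshape (irrational-major (subst (0ℤ ≤_) (e₁ x) hx) (1≤⇒0≤ hy) (subst (0ℤ ≤_) (e₂ x y) (1≤⇒0≤ t)))
  where
  e₁ : ∀ x → x ≡ - - x
  e₁ = solve-∀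
  e₂ : ∀ x y → - (x * x - + 5 * (y * y)) ≡ + 5 * (- y * - y) - - x * - x
  e₂ = solve-∀
nonNeg-total (x ⊹ y √5) ¬h | inj₂ hx | inj₁ hy with sign (+ 5 * (y * y) - x * x)
...   | inj₁ t = ⊥-elim (¬h (unshape (irrational-major (1≤⇒0≤ hx) hy t)))
...   | inj₂ t = unshape (rational-major (1≤⇒0≤ hx) (subst (0ℤ ≤_) (e₁ y) hy) (subst (0ℤ ≤_) (e₂ x y) (1≤⇒0≤ t)))
  where
  e₁ : ∀ y → y ≡ - - y
  e₁ = solve-∀
  e₂ : ∀ x y → - (+ 5 * (y * y) - x * x) ≡ - x * - x - + 5 * (- y * - y)
  e₂ = solve-∀

nonNeg? : ∀ u → Dec (NonNeg u)
nonNeg? (x ⊹ y √5) =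
  ((0ℤ ≤? x) ×-dec (0ℤ ≤? y))
  ⊎-dec ((((0ℤ ≤? x) ×-dec (y ≤? 0ℤ)) ×-dec (+ 5 * (y * y) ≤? x * x))
  ⊎-dec (((x ≤? 0ℤ) ×-dec (0ℤ ≤? y)) ×-dec (x * x ≤? + 5 * (y * y))))

nonNeg-⊗-both-nonNeg : ∀ {a b v} → 0ℤ ≤ a → 0ℤ ≤ b → NonNeg v → NonNeg ((a ⊹ b √5) ⊗ v)
nonNeg-⊗-both-nonNeg {a} {b} {c ⊹ d √5} ha hb hv =
  subst₂ NonNeg√5 (e a b c d) refl (nonNeg-⊕ (nonNeg-⊙ ha hv) (nonNeg-⊙ hb (nonNeg-√5⊗ hv)))
  where
  e : ∀ a b c d → a * c + b * (+ 5 * d) ≡ a * c + + 5 * (b * d)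
  e = solve-∀

-- Away from the positive quadrant the product is decided by the multiplicativity
-- of the norm x² - 5 y².
nonNeg-⊗ : ∀ {u v} → NonNeg u → NonNeg v → NonNeg (u ⊗ v)
nonNeg-⊗ {a ⊹ b √5} {c ⊹ d √5} hu hv with shape hu | shape hv
... | both-nonNeg ha hb | _ = nonNeg-⊗-both-nonNeg ha hb hv
... | _ | both-nonNeg hc hd = subst₂ NonNeg√5 (e₁ a b c d) (e₂ a b c d) (nonNeg-⊗-both-nonNeg hc hd hu)
  where
  e₁ : ∀ a b c d → c * a + + 5 * (d * b) ≡ a * c + + 5 * (b * d)
  e₁ = solve-∀
  e₂ : ∀ a b c d → c * b + d * a ≡ a * d + b * c
  e₂ = solve-∀
... | rational-major ha hb h₁ | rational-major hc hd h₂ =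
  unshape (rational-major (subst (0ℤ ≤_) (e₁ a b c d) (0≤-+ (0≤-* ha hc) (0≤-* 0≤5 (0≤-* hb hd))))
                          (subst (0ℤ ≤_) (e₂ a b c d) (0≤-+ (0≤-* ha hd) (0≤-* hb hc)))
                          (subst (0ℤ ≤_) (e₃ a b c d) (0≤-* h₁ h₂)))
  where
  e₁ : ∀ a b c d → a * c + + 5 * (- b * - d) ≡ a * c + + 5 * (b * d)
  e₁ = solve-∀
  e₂ : ∀ a b c d → a * - d + - b * c ≡ - (a * d + b * c)
  e₂ = solve-∀
  e₃ : ∀ a b c d → (a * a - + 5 * (b * b)) * (c * c - + 5 * (d * d))
                   ≡ (a * c + + 5 * (b * d)) * (a * c + + 5 * (b * d)) - + 5 * ((a * d + b * c) * (a * d + b * c))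
  e₃ = solve-∀
... | irrational-major ha hb h₁ | irrational-major hc hd h₂ =
  unshape (rational-major (subst (0ℤ ≤_) (e₁ a b c d) (0≤-+ (0≤-* ha hc) (0≤-* 0≤5 (0≤-* hb hd))))
                          (subst (0ℤ ≤_) (e₂ a b c d) (0≤-+ (0≤-* ha hd) (0≤-* hb hc)))
                          (subst (0ℤ ≤_) (e₃ a b c d) (0≤-* h₁ h₂)))
  where
  e₁ : ∀ a b c d → - a * - c + + 5 * (b * d) ≡ a * c + + 5 * (b * d)
  e₁ = solve-∀
  e₂ : ∀ a b c d → - a * d + b * - c ≡ - (a * d + b * c)
  e₂ = solve-∀
  e₃ : ∀ a b c d → (+ 5 * (b * b) - a * a) * (+ 5 * (d * d) - c * c)
                   ≡ (a * c + + 5 * (b * d)) * (a * c + + 5 * (b * d)) - + 5 * ((a * d + b * c) * (a * d + b * c))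
  e₃ = solve-∀
... | rational-major ha hb h₁ | irrational-major hc hd h₂ =
  unshape (irrational-major (subst (0ℤ ≤_) (e₁ a b c d) (0≤-+ (0≤-* ha hc) (0≤-* 0≤5 (0≤-* hb hd))))
                            (subst (0ℤ ≤_) (e₂ a b c d) (0≤-+ (0≤-* ha hd) (0≤-* hb hc)))
                            (subst (0ℤ ≤_) (e₃ a b c d) (0≤-* h₁ h₂)))
  where
  e₁ : ∀ a b c d → a * - c + + 5 * (- b * d) ≡ - (a * c + + 5 * (b * d))
  e₁ = solve-∀
  e₂ : ∀ a b c d → a * d + - b * - c ≡ a * d + b * c
  e₂ = solve-∀
  e₃ : ∀ a b c d → (a * a - + 5 * (b * b)) * (+ 5 * (d * d) - c * c)
                   ≡ + 5 * ((a * d + b * c) * (a * d + b * c)) - (a * c + + 5 * (b * d)) * (a * c + + 5 * (b * d))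
  e₃ = solve-∀
... | irrational-major ha hb h₁ | rational-major hc hd h₂ =
  unshape (irrational-major (subst (0ℤ ≤_) (e₁ a b c d) (0≤-+ (0≤-* ha hc) (0≤-* 0≤5 (0≤-* hb hd))))
                            (subst (0ℤ ≤_) (e₂ a b c d) (0≤-+ (0≤-* ha hd) (0≤-* hb hc)))
                            (subst (0ℤ ≤_) (e₃ a b c d) (0≤-* h₁ h₂)))
  where
  e₁ : ∀ a b c d → - a * c + + 5 * (b * - d) ≡ - (a * c + + 5 * (b * d))
  e₁ = solve-∀
  e₂ : ∀ a b c d → - a * - d + b * c ≡ a * d + b * c
  e₂ = solve-∀
  e₃ : ∀ a b c d → (+ 5 * (b * b) - a * a) * (c * c - + 5 * (d * d))
                   ≡ + 5 * ((a * d + b * c) * (a * d + b * c)) - (a * c + + 5 * (b * d)) * (a * c + + 5 * (b * d))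
  e₃ = solve-∀

pos⇒nonNeg : ∀ {u} → Pos u → NonNeg u
pos⇒nonNeg {x ⊹ y √5} p = subst₂ NonNeg√5 (e x) (e y) (nonNeg-total (⊖ (x ⊹ y √5)) p)
  where
  e : ∀ x → - - x ≡ x
  e = solve-∀

pos-⊕ : ∀ {u v} → Pos u → NonNeg v → Pos (u ⊕ v)
pos-⊕ {a ⊹ b √5} {c ⊹ d √5} pu hv h = pu (subst₂ NonNeg√5 (e a c) (e b d) (nonNeg-⊕ h hv))
  where
  e : ∀ a c → - (a + c) + c ≡ - a
  e = solve-∀

pos-⊙ : ∀ {k u} → 1ℤ ≤ k → Pos u → Pos (k ⊙ u)
pos-⊙ {k} {a ⊹ b √5} hk pu h = pu (nonNeg-⊙⁻¹ hk (subst₂ NonNeg√5 (e k a) (e k b) h))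
  where
  e : ∀ k a → - (k * a) ≡ k * - a
  e = solve-∀

pos-√5⊗ : ∀ {u} → Pos u → Pos (√5⊗ u)
pos-√5⊗ {a ⊹ b √5} pu h = pu (nonNeg-⊙⁻¹ {+ 5} (+≤+ (s≤s z≤n)) (subst₂ NonNeg√5 refl (e b) (nonNeg-√5⊗ h)))
  where
  e : ∀ b → - (+ 5 * b) ≡ + 5 * - b
  e = solve-∀

-- A positive v that is not in the positive quadrant has norm N ≥ 1 and a nonnegative
-- "conjugate" w with v ⊗ w = N; multiplying u ⊗ v ≤ 0 by w gives N u ≤ 0.
pos-⊗ : ∀ {u v} → Pos u → Pos v → Pos (u ⊗ v)
pos-⊗ {a ⊹ b √5} {c ⊹ d √5} pu pv with shape (pos⇒nonNeg pv)
... | both-nonNeg hc hd with sign′ c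
...   | inj₁ c≥1 =
  subst Pos (≡-⊹ (e₁ a b c d) (e₂ a b c d))
    (pos-⊕ (pos-⊙ c≥1 pu) (nonNeg-⊙ hd (nonNeg-√5⊗ (pos⇒nonNeg pu))))
  where
  e₁ : ∀ a b c d → c * a + d * (+ 5 * b) ≡ a * c + + 5 * (b * d)
  e₁ = solve-∀
  e₂ : ∀ a b c d → c * b + d * a ≡ a * d + b * c
  e₂ = solve-∀
...   | inj₂ c≤0 with sign′ d
...     | inj₁ d≥1 =
  subst Pos (≡-⊹ (e₁ a b c d) (e₂ a b c d))
    (pos-⊕ (pos-⊙ d≥1 (pos-√5⊗ pu)) (nonNeg-⊙ hc (pos⇒nonNeg pu)))
  where
  e₁ : ∀ a b c d → d * (+ 5 * b) + c * a ≡ a * c + + 5 * (b * d)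
  e₁ = solve-∀
  e₂ : ∀ a b c d → d * a + c * b ≡ a * d + b * c
  e₂ = solve-∀
...     | inj₂ d≤0 = ⊥-elim (pv (unshape (both-nonNeg c≤0 d≤0)))
pos-⊗ {a ⊹ b √5} {c ⊹ d √5} pu pv | rational-major hc hd h with sign′ (c * c - + 5 * (d * d))
... | inj₂ N≤0 = ⊥-elim (pv (unshape (irrational-major (subst (0ℤ ≤_) (e₁ c) hc) hd (subst (0ℤ ≤_) (e₂ c d) N≤0))))
  where
  e₁ : ∀ c → c ≡ - - c
  e₁ = solve-∀
  e₂ : ∀ c d → - (c * c - + 5 * (d * d)) ≡ + 5 * (- d * - d) - - c * - c
  e₂ = solve-∀
... | inj₁ N≥1 = λ h → pu (nonNeg-⊙⁻¹ N≥1 (subst₂ NonNeg√5 (e₁ a b c d) (e₂ a b c d) (nonNeg-⊗ h (unshape (both-nonNeg hc hd)))))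
  where
  e₁ : ∀ a b c d → - (a * c + + 5 * (b * d)) * c + + 5 * (- (a * d + b * c) * - d) ≡ (c * c - + 5 * (d * d)) * - a
  e₁ = solve-∀
  e₂ : ∀ a b c d → - (a * c + + 5 * (b * d)) * - d + - (a * d + b * c) * c ≡ (c * c - + 5 * (d * d)) * - b
  e₂ = solve-∀
pos-⊗ {a ⊹ b √5} {c ⊹ d √5} pu pv | irrational-major hc hd h with sign′ (+ 5 * (d * d) - c * c)
... | inj₂ M≤0 = ⊥-elim (pv (unshape (rational-major hc (subst (0ℤ ≤_) (e₁ d) hd) (subst (0ℤ ≤_) (e₂ c d) M≤0))))
  where
  e₁ : ∀ d → d ≡ - - d
  e₁ = solve-∀
  e₂ : ∀ c d → - (+ 5 * (d * d) - c * c) ≡ - c * - c - + 5 * (- d * - d)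
  e₂ = solve-∀
... | inj₁ M≥1 = λ h → pu (nonNeg-⊙⁻¹ M≥1 (subst₂ NonNeg√5 (e₁ a b c d) (e₂ a b c d) (nonNeg-⊗ h (unshape (both-nonNeg hc hd)))))
  where
  e₁ : ∀ a b c d → - (a * c + + 5 * (b * d)) * - c + + 5 * (- (a * d + b * c) * d) ≡ (+ 5 * (d * d) - c * c) * - a
  e₁ = solve-∀
  e₂ : ∀ a b c d → - (a * c + + 5 * (b * d)) * d + - (a * d + b * c) * - c ≡ (+ 5 * (d * d) - c * c) * - b
  e₂ = solve-∀

0ᴿ : ℝ5
0ᴿ = 0ℤ ⊹ 0ℤ √5

sumᴿ : List ℝ5 → ℝ5
sumᴿ [] = 0ᴿ
sumᴿ (u ∷ us) = u ⊕ sumᴿ us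

≰ᴿ⇒pos : ∀ u v → ¬ (u ≤ᴿ v) → Pos (u ⊖ v)
≰ᴿ⇒pos (a ⊹ b √5) (c ⊹ d √5) u≰v h = u≰v (subst₂ NonNeg√5 (e a c) (e b d) h)
  where
  e : ∀ a c → - (a - c) ≡ c - a
  e = solve-∀

nonNeg-square : ∀ u → NonNeg (u ⊗ u)
nonNeg-square u with nonNeg? u
... | yes h = nonNeg-⊗ h h
nonNeg-square (a ⊹ b √5) | no ¬h = subst₂ NonNeg√5 (e₁ a b) (e₂ a b) (nonNeg-⊗ h h)
  where
  h = nonNeg-total (a ⊹ b √5) ¬h
  e₁ : ∀ a b → - a * - a + + 5 * (- b * - b) ≡ a * a + + 5 * (b * b)
  e₁ = solve-∀
  e₂ : ∀ a b → - a * - b + - b * - a ≡ a * b + b * a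
  e₂ = solve-∀

nonNeg-sumᴿ : ∀ {us} → All NonNeg us → NonNeg (sumᴿ us)
nonNeg-sumᴿ []         = unshape (both-nonNeg (+≤+ z≤n) (+≤+ z≤n))
nonNeg-sumᴿ (h ∷ hs)   = nonNeg-⊕ h (nonNeg-sumᴿ hs)

pos-sumᴿ : ∀ {u us} → All Pos (u ∷ us) → Pos (sumᴿ (u ∷ us))
pos-sumᴿ (p ∷ ps) = pos-⊕ p (nonNeg-sumᴿ (All.map pos⇒nonNeg ps))

sumᴿ-differences-of-squares : ∀ a ps →
  sumᴿ (map (λ p → (a ⊕ + 2 ⊙ p) ⊗ (a ⊖ + 2 ⊙ p)) ps)
  ≡ + length ps ⊙ (a ⊗ a) ⊖ + 4 ⊙ sumᴿ (map (λ p → p ⊗ p) ps)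
sumᴿ-differences-of-squares (a ⊹ b √5) [] = ≡-⊹ (e a b) (e a b)
  where
  e : ∀ a b → 0ℤ ≡ + 0 * (a * b) - + 4 * 0ℤ
  e = solve-∀
sumᴿ-differences-of-squares a (p ∷ ps) =
  trans (cong ((a ⊕ + 2 ⊙ p) ⊗ (a ⊖ + 2 ⊙ p) ⊕_) (sumᴿ-differences-of-squares a ps))
        (step a p (sumᴿ (map (λ p → p ⊗ p) ps)) (+ length ps))
  where
  step : ∀ a p s k → (a ⊕ + 2 ⊙ p) ⊗ (a ⊖ + 2 ⊙ p) ⊕ (k ⊙ (a ⊗ a) ⊖ + 4 ⊙ s) ≡ (1ℤ + k) ⊙ (a ⊗ a) ⊖ + 4 ⊙ (p ⊗ p ⊕ s)
  step (a ⊹ b √5) (c ⊹ d √5) (s ⊹ t √5) k = ≡-⊹ (identityˣ a b c d s k) (identityʸ a b c d t k)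
    where
    identityˣ : ∀ a b c d s k →
      let m = λ a b c d → a * c + + 5 * (b * d)
      in m (a + + 2 * c) (b + + 2 * d) (a - + 2 * c) (b - + 2 * d) + (k * m a b a b - + 4 * s)
         ≡ (1ℤ + k) * m a b a b - + 4 * (m c d c d + s)
    identityˣ = solve-∀
    identityʸ : ∀ a b c d t k →
      let m = λ a b c d → a * d + b * c
      in m (a + + 2 * c) (b + + 2 * d) (a - + 2 * c) (b - + 2 * d) + (k * m a b a b - + 4 * t)
         ≡ (1ℤ + k) * m a b a b - + 4 * (m c d c d + t)
    identityʸ = solve-∀

≤ᴿ-refl : ∀ u → u ≤ᴿ u
≤ᴿ-refl (a ⊹ b √5) = subst₂ NonNeg√5 (e a) (e b) (unshape (both-nonNeg (+≤+ z≤n) (+≤+ z≤n)))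
  where
  e : ∀ a → 0ℤ ≡ a - a
  e = solve-∀

≤ᴿ-trans : ∀ u v w → u ≤ᴿ v → v ≤ᴿ w → u ≤ᴿ w
≤ᴿ-trans (a ⊹ b √5) (c ⊹ d √5) (e ⊹ f √5) u≤v v≤w = subst₂ NonNeg√5 (eq a c e) (eq b d f) (nonNeg-⊕ u≤v v≤w)
  where
  eq : ∀ a c e → c - a + (e - c) ≡ e - a
  eq = solve-∀

_≤ᴿ?_ : ∀ u v → Dec (u ≤ᴿ v)
u ≤ᴿ? v = nonNeg? (v ⊖ u)

-- The Hermitian form on ℤ[ζ₅]

_+ᴷ_ : OK → OK → OK
⟨ a , b , c , d ⟩ +ᴷ ⟨ a' , b' , c' , d' ⟩ = ⟨ a + a' , b + b' , c + c' , d + d' ⟩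

-ᴷ_ : OK → OK
-ᴷ ⟨ a , b , c , d ⟩ = ⟨ - a , - b , - c , - d ⟩

0ᴷ : OK
0ᴷ = ⟨ + 0 , + 0 , + 0 , + 0 ⟩

≡-⟨⟩ : ∀ {a b c d a' b' c' d'} → a ≡ a' → b ≡ b' → c ≡ c' → d ≡ d' → ⟨ a , b , c , d ⟩ ≡ ⟨ a' , b' , c' , d' ⟩
≡-⟨⟩ refl refl refl refl = refl

σ-+ᴷ : ∀ u v → σ (u +ᴷ v) ≡ σ u +ᴷ σ v
σ-+ᴷ u v = ≡-⟨⟩ (e (a0 u) (a2 u) (a0 v) (a2 v)) (e (a3 u) (a2 u) (a3 v) (a2 v)) (e (a1 u) (a2 u) (a1 v) (a2 v)) (e 0ℤ (a2 u) 0ℤ (a2 v))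
  where
  e : ∀ a c a' c' → (a + a') - (c + c') ≡ (a - c) + (a' - c')
  e = solve-∀

σ--ᴷ : ∀ u v → σ (u -ᴷ v) ≡ σ u -ᴷ σ v
σ--ᴷ u v = ≡-⟨⟩ (e (a0 u) (a2 u) (a0 v) (a2 v)) (e (a3 u) (a2 u) (a3 v) (a2 v)) (e (a1 u) (a2 u) (a1 v) (a2 v)) (e 0ℤ (a2 u) 0ℤ (a2 v))
  where
  e : ∀ a c a' c' → (a - a') - (c - c') ≡ (a - c) - (a' - c')
  e = solve-∀

z+ᴷg-ᴷz≡g : ∀ z g → (z +ᴷ g) -ᴷ z ≡ g
z+ᴷg-ᴷz≡g z g = ≡-⟨⟩ (e (a0 z) (a0 g)) (e (a1 z) (a1 g)) (e (a2 z) (a2 g)) (e (a3 z) (a3 g))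
  where
  e : ∀ a b → a + b - a ≡ b
  e = solve-∀

z+ᴷ[w-ᴷz]≡w : ∀ z w → z +ᴷ (w -ᴷ z) ≡ w
z+ᴷ[w-ᴷz]≡w z w = ≡-⟨⟩ (e (a0 z) (a0 w)) (e (a1 z) (a1 w)) (e (a2 z) (a2 w)) (e (a3 z) (a3 w))
  where
  e : ∀ a b → a + (b - a) ≡ b
  e = solve-∀

z-ᴷz≡0ᴷ : ∀ z → z -ᴷ z ≡ 0ᴷ
z-ᴷz≡0ᴷ z = ≡-⟨⟩ (e (a0 z)) (e (a1 z)) (e (a2 z)) (e (a3 z))
  where
  e : ∀ a → a - a ≡ + 0
  e = solve-∀

w-ᴷz≡0ᴷ⇒w≡z : ∀ {w z} → w -ᴷ z ≡ 0ᴷ → w ≡ z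
w-ᴷz≡0ᴷ⇒w≡z eq = ≡-⟨⟩ (i-j≡0⇒i≡j _ _ (cong a0 eq)) (i-j≡0⇒i≡j _ _ (cong a1 eq)) (i-j≡0⇒i≡j _ _ (cong a2 eq)) (i-j≡0⇒i≡j _ _ (cong a3 eq))

sumSq : List ℤ → ℤ
sumSq []       = 0ℤ
sumSq (x ∷ xs) = x * x + sumSq xs

0≤-sumSq : ∀ xs → 0ℤ ≤ sumSq xs
0≤-sumSq []       = +≤+ z≤n
0≤-sumSq (x ∷ xs) = 0≤-+ (0≤-square x) (0≤-sumSq xs)

square-≤-sumSq : ∀ {x xs} → x ∈ xs → 0ℤ ≤ sumSq xs - x * x
square-≤-sumSq {x} {y ∷ xs} (here refl) = subst (0ℤ ≤_) (e x (sumSq xs)) (0≤-sumSq xs)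
  where
  e : ∀ x s → s ≡ x * x + s - x * x
  e = solve-∀
square-≤-sumSq {x} {y ∷ xs} (there x∈xs) = subst (0ℤ ≤_) (e x y (sumSq xs)) (0≤-+ (0≤-square y) (square-≤-sumSq x∈xs))
  where
  e : ∀ x y s → y * y + (s - x * x) ≡ y * y + s - x * x
  e = solve-∀

-- The sum of squares of this list is the rational part of 4|v|², i.e. 2 (|v|² + |v^σ|²).
spread : OK → List ℤ
spread ⟨ a , b , c , d ⟩ = a ∷ b ∷ c ∷ d ∷ a - b ∷ a - c ∷ a - d ∷ b - c ∷ b - d ∷ c - d ∷ []

-- ⟪ u , v ⟫ = 4 Re (u v̄), the polarisation of absSq.
⟪_,_⟫ : OK → OK → ℝ5
⟪ ⟨ a , b , c , d ⟩ , ⟨ a' , b' , c' , d' ⟩ ⟫ =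
  (+ 4 * (a * a' + b * b' + c * c' + d * d')
     - (a * (b' + c' + d') + b * (a' + c' + d') + c * (a' + b' + d') + d * (a' + b' + c')))
  ⊹ (a * b' + b * a' - (a * c' + c * a') - (a * d' + d * a') + (b * c' + c * b') - (b * d' + d * b') + (c * d' + d * c')) √5

-- solve-∀ cannot unfold definitions, so the identities below spell them out: here the
-- left-hand sides are absSq ⟨ a , b , c , d ⟩ with conj, _*ᴷ_ and Re unfolded, and
-- further down the let-bound Q, B repeat ⟪_,_⟫.
absSq-⟪⟫ : ∀ v → absSq v ≡ ⟪ v , v ⟫
absSq-⟪⟫ v = ≡-⊹ (unfoldedˣ (a0 v) (a1 v) (a2 v) (a3 v)) (unfoldedʸ (a0 v) (a1 v) (a2 v) (a3 v))
  where
  unfoldedˣ : ∀ a b c d →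
    let e = a - b ; f = + 0 - b ; g = d - b ; h = c - b
        c₀ = a * e + c * h + d * g ; c₁ = a * f + b * e + d * h ; c₂ = a * g + b * f + c * e
        c₃ = a * h + b * g + c * f + d * e ; c₄ = b * h + c * g + d * f
    in + 4 * (c₀ - c₄) - (c₁ - c₄) - (c₂ - c₄) - (c₃ - c₄)
       ≡ + 4 * (a * a + b * b + c * c + d * d) - (a * (b + c + d) + b * (a + c + d) + c * (a + b + d) + d * (a + b + c))
  unfoldedˣ = solve-∀
  unfoldedʸ : ∀ a b c d →
    let e = a - b ; f = + 0 - b ; g = d - b ; h = c - b
        c₀ = a * e + c * h + d * g ; c₁ = a * f + b * e + d * h ; c₂ = a * g + b * f + c * e
        c₃ = a * h + b * g + c * f + d * e ; c₄ = b * h + c * g + d * f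
    in c₁ - c₄ - (c₂ - c₄) - (c₃ - c₄)
       ≡ a * b + b * a - (a * c + c * a) - (a * d + d * a) + (b * c + c * b) - (b * d + d * b) + (c * d + d * c)
  unfoldedʸ = solve-∀

absSq-spread : ∀ v → ℝ5.x (absSq v) ≡ sumSq (spread v)
absSq-spread v = trans (cong ℝ5.x (absSq-⟪⟫ v)) (identity (a0 v) (a1 v) (a2 v) (a3 v))
  where
  identity : ∀ a b c d →
    + 4 * (a * a + b * b + c * c + d * d) - (a * (b + c + d) + b * (a + c + d) + c * (a + b + d) + d * (a + b + c))
    ≡ a * a + (b * b + (c * c + (d * d + ((a - b) * (a - b) + ((a - c) * (a - c) + ((a - d) * (a - d)
      + ((b - c) * (b - c) + ((b - d) * (b - d) + ((c - d) * (c - d) + + 0)))))))))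
  identity = solve-∀

conj√5 : ℝ5 → ℝ5
conj√5 (x ⊹ y √5) = x ⊹ (- y) √5

absSq-σ : ∀ v → absSq (σ v) ≡ conj√5 (absSq v)
absSq-σ v = trans (absSq-⟪⟫ (σ v))
  (trans (≡-⊹ (identityˣ (a0 v) (a1 v) (a2 v) (a3 v)) (identityʸ (a0 v) (a1 v) (a2 v) (a3 v)))
         (cong conj√5 (sym (absSq-⟪⟫ v))))
  where
  identityˣ : ∀ a b c d →
    let Q = λ a b c d → + 4 * (a * a + b * b + c * c + d * d) - (a * (b + c + d) + b * (a + c + d) + c * (a + b + d) + d * (a + b + c))
    in Q (a - c) (d - c) (b - c) (+ 0 - c) ≡ Q a b c d
  identityˣ = solve-∀
  identityʸ : ∀ a b c d →
    let Q = λ a b c d → a * b + b * a - (a * c + c * a) - (a * d + d * a) + (b * c + c * b) - (b * d + d * b) + (c * d + d * c)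
    in Q (a - c) (d - c) (b - c) (+ 0 - c) ≡ - Q a b c d
  identityʸ = solve-∀

absSq-+ᴷ : ∀ u v → absSq (u +ᴷ v) ≡ absSq u ⊕ absSq v ⊕ + 2 ⊙ ⟪ u , v ⟫
absSq-+ᴷ u v = trans (absSq-⟪⟫ (u +ᴷ v))
  (trans (≡-⊹ (identityˣ (a0 u) (a1 u) (a2 u) (a3 u) (a0 v) (a1 v) (a2 v) (a3 v))
              (identityʸ (a0 u) (a1 u) (a2 u) (a3 u) (a0 v) (a1 v) (a2 v) (a3 v)))
         (cong₂ (λ s t → s ⊕ t ⊕ + 2 ⊙ ⟪ u , v ⟫) (sym (absSq-⟪⟫ u)) (sym (absSq-⟪⟫ v))))
  where
  identityˣ : ∀ a b c d a' b' c' d' →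
    let B = λ a b c d a' b' c' d' → + 4 * (a * a' + b * b' + c * c' + d * d') - (a * (b' + c' + d') + b * (a' + c' + d') + c * (a' + b' + d') + d * (a' + b' + c'))
    in B (a + a') (b + b') (c + c') (d + d') (a + a') (b + b') (c + c') (d + d')
       ≡ B a b c d a b c d + B a' b' c' d' a' b' c' d' + + 2 * B a b c d a' b' c' d'
  identityˣ = solve-∀
  identityʸ : ∀ a b c d a' b' c' d' →
    let B = λ a b c d a' b' c' d' → a * b' + b * a' - (a * c' + c * a') - (a * d' + d * a') + (b * c' + c * b') - (b * d' + d * b') + (c * d' + d * c')
    in B (a + a') (b + b') (c + c') (d + d') (a + a') (b + b') (c + c') (d + d')
       ≡ B a b c d a b c d + B a' b' c' d' a' b' c' d' + + 2 * B a b c d a' b' c' d'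
  identityʸ = solve-∀

absSq--ᴷ : ∀ u v → absSq (u -ᴷ v) ≡ absSq u ⊕ absSq v ⊖ + 2 ⊙ ⟪ u , v ⟫
absSq--ᴷ u v = trans (absSq-⟪⟫ (u -ᴷ v))
  (trans (≡-⊹ (identityˣ (a0 u) (a1 u) (a2 u) (a3 u) (a0 v) (a1 v) (a2 v) (a3 v))
              (identityʸ (a0 u) (a1 u) (a2 u) (a3 u) (a0 v) (a1 v) (a2 v) (a3 v)))
         (cong₂ (λ s t → s ⊕ t ⊖ + 2 ⊙ ⟪ u , v ⟫) (sym (absSq-⟪⟫ u)) (sym (absSq-⟪⟫ v))))
  where
  identityˣ : ∀ a b c d a' b' c' d' →
    let B = λ a b c d a' b' c' d' → + 4 * (a * a' + b * b' + c * c' + d * d') - (a * (b' + c' + d') + b * (a' + c' + d') + c * (a' + b' + d') + d * (a' + b' + c'))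
    in B (a - a') (b - b') (c - c') (d - d') (a - a') (b - b') (c - c') (d - d')
       ≡ B a b c d a b c d + B a' b' c' d' a' b' c' d' - + 2 * B a b c d a' b' c' d'
  identityˣ = solve-∀
  identityʸ : ∀ a b c d a' b' c' d' →
    let B = λ a b c d a' b' c' d' → a * b' + b * a' - (a * c' + c * a') - (a * d' + d * a') + (b * c' + c * b') - (b * d' + d * b') + (c * d' + d * c')
    in B (a - a') (b - b') (c - c') (d - d') (a - a') (b - b') (c - c') (d - d')
       ≡ B a b c d a b c d + B a' b' c' d' a' b' c' d' - + 2 * B a b c d a' b' c' d'
  identityʸ = solve-∀

ζ⁰ ζ¹ ζ² ζ³ ζ⁴ : OK
ζ⁰ = ⟨ + 1 , + 0 , + 0 , + 0 ⟩
ζ¹ = ⟨ + 0 , + 1 , + 0 , + 0 ⟩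
ζ² = ⟨ + 0 , + 0 , + 1 , + 0 ⟩
ζ³ = ⟨ + 0 , + 0 , + 0 , + 1 ⟩
ζ⁴ = ⟨ - + 1 , - + 1 , - + 1 , - + 1 ⟩

fifthRoots : List OK
fifthRoots = ζ⁰ ∷ ζ¹ ∷ ζ² ∷ ζ³ ∷ ζ⁴ ∷ []

⟪⟫-tight-frame : ∀ w → sumᴿ (map (λ ε → ⟪ w , ε ⟫ ⊗ ⟪ w , ε ⟫) fifthRoots) ≡ + 10 ⊙ absSq w
⟪⟫-tight-frame w = trans (≡-⊹ (identityˣ (a0 w) (a1 w) (a2 w) (a3 w)) (identityʸ (a0 w) (a1 w) (a2 w) (a3 w)))
                         (cong (+ 10 ⊙_) (sym (absSq-⟪⟫ w)))
  where
  identityˣ : ∀ a b c d →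
    let Bˣ = λ a b c d a' b' c' d' → + 4 * (a * a' + b * b' + c * c' + d * d') - (a * (b' + c' + d') + b * (a' + c' + d') + c * (a' + b' + d') + d * (a' + b' + c'))
        Bʸ = λ a b c d a' b' c' d' → a * b' + b * a' - (a * c' + c * a') - (a * d' + d * a') + (b * c' + c * b') - (b * d' + d * b') + (c * d' + d * c')
        S = λ a' b' c' d' → Bˣ a b c d a' b' c' d' * Bˣ a b c d a' b' c' d' + + 5 * (Bʸ a b c d a' b' c' d' * Bʸ a b c d a' b' c' d')
    in S (+ 1) (+ 0) (+ 0) (+ 0) + (S (+ 0) (+ 1) (+ 0) (+ 0) + (S (+ 0) (+ 0) (+ 1) (+ 0) + (S (+ 0) (+ 0) (+ 0) (+ 1)
         + (S (- + 1) (- + 1) (- + 1) (- + 1) + 0ℤ))))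
       ≡ + 10 * Bˣ a b c d a b c d
  identityˣ = solve-∀
  identityʸ : ∀ a b c d →
    let Bˣ = λ a b c d a' b' c' d' → + 4 * (a * a' + b * b' + c * c' + d * d') - (a * (b' + c' + d') + b * (a' + c' + d') + c * (a' + b' + d') + d * (a' + b' + c'))
        Bʸ = λ a b c d a' b' c' d' → a * b' + b * a' - (a * c' + c * a') - (a * d' + d * a') + (b * c' + c * b') - (b * d' + d * b') + (c * d' + d * c')
        S = λ a' b' c' d' → Bˣ a b c d a' b' c' d' * Bʸ a b c d a' b' c' d' + Bʸ a b c d a' b' c' d' * Bˣ a b c d a' b' c' d'
    in S (+ 1) (+ 0) (+ 0) (+ 0) + (S (+ 0) (+ 1) (+ 0) (+ 0) + (S (+ 0) (+ 0) (+ 1) (+ 0) + (S (+ 0) (+ 0) (+ 0) (+ 1)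
         + (S (- + 1) (- + 1) (- + 1) (- + 1) + 0ℤ))))
       ≡ + 10 * Bʸ a b c d a b c d
  identityʸ = solve-∀

absSq-nonNeg : ∀ w → NonNeg (absSq w)
absSq-nonNeg w = nonNeg-⊙⁻¹ {+ 10} (+≤+ (s≤s z≤n))
  (subst NonNeg (⟪⟫-tight-frame w) (nonNeg-sumᴿ (squares (map ⟪ w ,_⟫ fifthRoots))))
  where
  squares : ∀ ps → All NonNeg (map (λ p → p ⊗ p) ps)
  squares []       = []
  squares (p ∷ ps) = nonNeg-square p ∷ squares ps

parallelogram : ∀ u v → absSq (u -ᴷ v) ≡ + 2 ⊙ absSq u ⊕ + 2 ⊙ absSq v ⊖ absSq (u +ᴷ v)
parallelogram u v =
  trans (absSq--ᴷ u v)
        (trans (regroup (absSq u) (absSq v) ⟪ u , v ⟫) (cong (λ s → + 2 ⊙ absSq u ⊕ + 2 ⊙ absSq v ⊖ s) (sym (absSq-+ᴷ u v))))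
  where
  regroup : ∀ a b p → a ⊕ b ⊖ + 2 ⊙ p ≡ + 2 ⊙ a ⊕ + 2 ⊙ b ⊖ (a ⊕ b ⊕ + 2 ⊙ p)
  regroup (a ⊹ b √5) (c ⊹ d √5) (p ⊹ q √5) = ≡-⊹ (e a c p) (e b d q)
    where
    e : ∀ a c p → a + c - + 2 * p ≡ + 2 * a + + 2 * c - (a + c + + 2 * p)
    e = solve-∀

-- A neighbour at distance 1

InS? : ∀ z → Dec (InS z)
InS? z = absSq (σ z) ≤ᴿ? oneᴿ

outside-pair : ∀ w ε → absSq ε ≡ oneᴿ → ¬ (absSq (w +ᴷ ε) ≤ᴿ oneᴿ) → ¬ (absSq (w -ᴷ ε) ≤ᴿ oneᴿ) →
  Pos ((absSq w ⊕ + 2 ⊙ ⟪ w , ε ⟫) ⊗ (absSq w ⊖ + 2 ⊙ ⟪ w , ε ⟫))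
outside-pair w ε |ε|≡1 out₊ out₋ =
  pos-⊗ (subst Pos (trans (cong (_⊖ oneᴿ) (absSq-+ᴷ w ε)) (cancel₊ (absSq w) (absSq ε) (+ 2 ⊙ ⟪ w , ε ⟫) |ε|≡1))
                   (≰ᴿ⇒pos (absSq (w +ᴷ ε)) oneᴿ out₊))
        (subst Pos (trans (cong (_⊖ oneᴿ) (absSq--ᴷ w ε)) (cancel₋ (absSq w) (absSq ε) (+ 2 ⊙ ⟪ w , ε ⟫) |ε|≡1))
                   (≰ᴿ⇒pos (absSq (w -ᴷ ε)) oneᴿ out₋))
  where
  cancel₊ : ∀ a u p → u ≡ oneᴿ → a ⊕ u ⊕ p ⊖ oneᴿ ≡ a ⊕ p
  cancel₊ (a ⊹ b √5) _ (c ⊹ d √5) refl = ≡-⊹ (e a c (+ 4)) (e b d (+ 0))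
    where
    e : ∀ a c k → a + k + c - k ≡ a + c
    e = solve-∀
  cancel₋ : ∀ a u p → u ≡ oneᴿ → a ⊕ u ⊖ p ⊖ oneᴿ ≡ a ⊖ p
  cancel₋ (a ⊹ b √5) _ (c ⊹ d √5) refl = ≡-⊹ (e a c (+ 4)) (e b d (+ 0))
    where
    e : ∀ a c k → a + k - c - k ≡ a - c
    e = solve-∀

-- The tenth roots of unity, ordered so that σ maps them to ζ⁰, …, ζ⁴, -ζ⁰, …, -ζ⁴.
units : List OK
units = ζ⁰ ∷ ζ³ ∷ ζ¹ ∷ ζ⁴ ∷ ζ² ∷ -ᴷ ζ⁰ ∷ -ᴷ ζ³ ∷ -ᴷ ζ¹ ∷ -ᴷ ζ⁴ ∷ -ᴷ ζ² ∷ []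

unit-disc-not-encircled : ∀ w → absSq w ≤ᴿ oneᴿ → ¬ All (λ e → ¬ (absSq (w +ᴷ σ e) ≤ᴿ oneᴿ)) units
unit-disc-not-encircled w w∈disc (o₀ ∷ o₁ ∷ o₂ ∷ o₃ ∷ o₄ ∷ o₅ ∷ o₆ ∷ o₇ ∷ o₈ ∷ o₉ ∷ []) =
  subst Pos sum≡ (pos-sumᴿ pairs) nonPositive
  where
  A = absSq w
  ps = map ⟪ w ,_⟫ fifthRoots
  pairs : All Pos (map (λ p → (A ⊕ + 2 ⊙ p) ⊗ (A ⊖ + 2 ⊙ p)) ps)
  pairs = outside-pair w ζ⁰ refl o₀ o₅ ∷ outside-pair w ζ¹ refl o₁ o₆ ∷ outside-pair w ζ² refl o₂ o₇
        ∷ outside-pair w ζ³ refl o₃ o₈ ∷ outside-pair w ζ⁴ refl o₄ o₉ ∷ []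
  sum≡ : sumᴿ (map (λ p → (A ⊕ + 2 ⊙ p) ⊗ (A ⊖ + 2 ⊙ p)) ps) ≡ + 5 ⊙ (A ⊗ A) ⊖ + 4 ⊙ (+ 10 ⊙ A)
  sum≡ = trans (sumᴿ-differences-of-squares A ps) (cong (λ s → + 5 ⊙ (A ⊗ A) ⊖ + 4 ⊙ s) (⟪⟫-tight-frame w))
  factorised : ∀ a → + 5 ⊙ (a ⊗ (oneᴿ ⊖ a ⊕ oneᴿ)) ≡ ⊖ (+ 5 ⊙ (a ⊗ a) ⊖ + 4 ⊙ (+ 10 ⊙ a))
  factorised (a ⊹ b √5) = ≡-⊹ (eˣ a b) (eʸ a b)
    where
    eˣ : ∀ a b → + 5 * (a * (+ 4 - a + + 4) + + 5 * (b * (+ 0 - b + + 0))) ≡ - (+ 5 * (a * a + + 5 * (b * b)) - + 4 * (+ 10 * a))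
    eˣ = solve-∀
    eʸ : ∀ a b → + 5 * (a * (+ 0 - b + + 0) + b * (+ 4 - a + + 4)) ≡ - (+ 5 * (a * b + b * a) - + 4 * (+ 10 * b))
    eʸ = solve-∀
  nonPositive : NonNeg (⊖ (+ 5 ⊙ (A ⊗ A) ⊖ + 4 ⊙ (+ 10 ⊙ A)))
  nonPositive = subst NonNeg (factorised A)
    (nonNeg-⊙ 0≤5 (nonNeg-⊗ (absSq-nonNeg w) (nonNeg-⊕ w∈disc (unshape (both-nonNeg (+≤+ z≤n) (+≤+ z≤n))))))

unit-neighbour : ∀ z → InS z → Any (λ e → InS (z +ᴷ e)) units
unit-neighbour z z∈S = decided (any? (λ e → InS? (z +ᴷ e)) units)
  where
  outside : ∀ {e} → ¬ InS (z +ᴷ e) → ¬ (absSq (σ z +ᴷ σ e) ≤ᴿ oneᴿ)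
  outside {e} = subst (λ v → ¬ (absSq v ≤ᴿ oneᴿ)) (σ-+ᴷ z e)
  decided : Dec (Any (λ e → InS (z +ᴷ e)) units) → Any (λ e → InS (z +ᴷ e)) units
  decided (yes found) = found
  decided (no none)   = ⊥-elim (unit-disc-not-encircled (σ z) z∈S (All.map outside (¬Any⇒All¬ units none)))

-- Short differences

_≟ᴷ_ : DecidableEquality OK
⟨ a , b , c , d ⟩ ≟ᴷ ⟨ a' , b' , c' , d' ⟩ =
  map′ (λ { (refl , refl , refl , refl) → refl }) (λ { refl → refl , refl , refl , refl })
       ((a ≟ a') ×-dec (b ≟ b') ×-dec (c ≟ c') ×-dec (d ≟ d'))

open import Data.List.Membership.DecPropositional _≟ᴷ_ using (_∈?_)

-- The ten elements ±ζᵏ (1 + ζ²), of absolute value (√5 - 1)/2.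
goldens : List OK
goldens = ⟨ - + 1 , + 0 , - + 1 , - + 1 ⟩ ∷ ⟨ + 1 , + 0 , + 1 , + 0 ⟩ ∷ ⟨ + 0 , + 1 , + 0 , + 1 ⟩
        ∷ ⟨ - + 1 , - + 1 , + 0 , - + 1 ⟩ ∷ ⟨ + 1 , + 0 , + 0 , + 1 ⟩ ∷ ⟨ + 1 , + 0 , + 1 , + 1 ⟩
        ∷ ⟨ - + 1 , + 0 , - + 1 , + 0 ⟩ ∷ ⟨ + 0 , - + 1 , + 0 , - + 1 ⟩ ∷ ⟨ + 1 , + 1 , + 0 , + 1 ⟩
        ∷ ⟨ - + 1 , + 0 , + 0 , - + 1 ⟩ ∷ []

-- For a difference of two points of 𝒮 the last alternative is excluded by σ-difference-bound.
Gap : OK → Set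
Gap d = d ≡ 0ᴷ ⊎ d ∈ goldens ⊎ oneᴿ ≤ᴿ absSq d ⊎ ¬ (absSq (σ d) ≤ᴿ (+ 4 ⊙ oneᴿ))

gap? : ∀ d → Dec (Gap d)
gap? d = (d ≟ᴷ 0ᴷ) ⊎-dec (d ∈? goldens) ⊎-dec (oneᴿ ≤ᴿ? absSq d) ⊎-dec ¬? (absSq (σ d) ≤ᴿ? (+ 4 ⊙ oneᴿ))

boxRange : List ℤ
boxRange = - + 3 ∷ - + 2 ∷ - + 1 ∷ + 0 ∷ + 1 ∷ + 2 ∷ + 3 ∷ []

Box : (OK → Set) → Set
Box P = All (λ a → All (λ b → All (λ c → All (λ d → P ⟨ a , b , c , d ⟩) boxRange) boxRange) boxRange) boxRange

gap-on-box : Box Gap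
gap-on-box = toWitness {a? = all? (λ a → all? (λ b → all? (λ c → all? (λ d → gap? ⟨ a , b , c , d ⟩) boxRange) boxRange) boxRange) boxRange} _

large-square : ∀ c → 1ℤ ≤ c - + 3 → 0ℤ ≤ + 9 - c * c → ⊥
large-square c h₁ h₂ = 1≰0 (1≤-+ (1≤-* h₁ (1≤-+ h₁ (+≤+ z≤n))) h₂) (e c)
  where
  e : ∀ c → (c - + 3) * (c - + 3 + + 6) + (+ 9 - c * c) ≡ 0ℤ
  e = solve-∀

∈-boxRange : ∀ c → 0ℤ ≤ + 9 - c * c → c ∈ boxRange
∈-boxRange (+ 0)                           _ = there (there (there (here refl)))
∈-boxRange (+ 1)                           _ = there (there (there (there (here refl))))
∈-boxRange (+ 2)                           _ = there (there (there (there (there (here refl)))))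
∈-boxRange (+ 3)                           _ = there (there (there (there (there (there (here refl))))))
∈-boxRange c@(+ suc (suc (suc (suc n))))   h = ⊥-elim (large-square c (+≤+ (s≤s z≤n)) h)
∈-boxRange -[1+ 0 ]                        _ = there (there (here refl))
∈-boxRange -[1+ 1 ]                        _ = there (here refl)
∈-boxRange -[1+ 2 ]                        _ = here refl
∈-boxRange c@(-[1+ suc (suc (suc n)) ])    h = ⊥-elim (large-square (- c) (+≤+ (s≤s z≤n)) (subst (0ℤ ≤_) (e c) h))
  where
  e : ∀ c → + 9 - c * c ≡ + 9 - - c * - c
  e = solve-∀

∈-box : ∀ {P} → Box P → ∀ d → 0ℤ ≤ + 9 - ℝ5.x (absSq d) → P d
∈-box box d h = lookup (lookup (lookup (lookup box (coordinate (here refl))) (coordinate (there (here refl))))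
                         (coordinate (there (there (here refl))))) (coordinate (there (there (there (here refl)))))
  where
  coordinate : ∀ {c} → c ∈ spread d → c ∈ boxRange
  coordinate {c} c∈ = ∈-boxRange c (subst (0ℤ ≤_) (e (ℝ5.x (absSq d)) (sumSq (spread d)) (c * c))
    (0≤-+ h (subst (λ s → 0ℤ ≤ s - c * c) (sym (absSq-spread d)) (square-≤-sumSq c∈))))
    where
    e : ∀ A s c → + 9 - A + (A - c) ≡ + 9 - c
    e = solve-∀

σ-difference-bound : ∀ z w → InS z → InS w → absSq (σ (w -ᴷ z)) ≤ᴿ (+ 4 ⊙ oneᴿ)
σ-difference-bound z w z∈S w∈S =
  subst (λ v → absSq v ≤ᴿ (+ 4 ⊙ oneᴿ)) (sym (σ--ᴷ w z))
    (subst (λ s → s ≤ᴿ (+ 4 ⊙ oneᴿ)) (sym (parallelogram (σ w) (σ z)))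
      (subst NonNeg (regroup oneᴿ (absSq (σ w)) (absSq (σ z)) (absSq (σ w +ᴷ σ z)))
        (nonNeg-⊕ (nonNeg-⊕ (nonNeg-⊙ 0≤2 w∈S) (nonNeg-⊙ 0≤2 z∈S)) (absSq-nonNeg (σ w +ᴷ σ z)))))
  where
  0≤2 : 0ℤ ≤ + 2
  0≤2 = +≤+ z≤n
  regroup : ∀ c u v s → + 2 ⊙ (c ⊖ u) ⊕ + 2 ⊙ (c ⊖ v) ⊕ s ≡ + 4 ⊙ c ⊖ (+ 2 ⊙ u ⊕ + 2 ⊙ v ⊖ s)
  regroup (c ⊹ c' √5) (u ⊹ u' √5) (v ⊹ v' √5) (s ⊹ s' √5) = ≡-⊹ (e c u v s) (e c' u' v' s')
    where
    e : ∀ c u v s → + 2 * (c - u) + + 2 * (c - v) + s ≡ + 4 * c - (+ 2 * u + + 2 * v - s)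
    e = solve-∀

-- ℝ5.x (absSq d) = 2 (|d|² + |d^σ|²) < 2 (1 + 4).
trace-bound : ∀ d → absSq (σ d) ≤ᴿ (+ 4 ⊙ oneᴿ) → ¬ (oneᴿ ≤ᴿ absSq d) → 0ℤ ≤ + 9 - ℝ5.x (absSq d)
trace-bound d bound short = bounded (absSq d) (subst (_≤ᴿ (+ 4 ⊙ oneᴿ)) (absSq-σ d) bound) short
  where
  bounded : ∀ u → conj√5 u ≤ᴿ (+ 4 ⊙ oneᴿ) → ¬ (oneᴿ ≤ᴿ u) → 0ℤ ≤ + 9 - ℝ5.x u
  bounded (a ⊹ b √5) h ¬h with sign (+ 9 - a)
  ... | inj₁ r = r
  ... | inj₂ r = ⊥-elim (¬h (subst₂ NonNeg√5 (e₁ a) (e₂ b) (nonNeg-+ˣ (0≤-+ r′ r′) h)))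
    where
    r′ = i≤j⇒0≤j-i r
    e₁ : ∀ a → + 16 - a + (- (+ 9 - a) - + 1 + (- (+ 9 - a) - + 1)) ≡ a - + 4
    e₁ = solve-∀
    e₂ : ∀ b → + 0 - - b ≡ b - + 0
    e₂ = solve-∀

gap : ∀ z w → InS z → InS w → w ≢ z → w -ᴷ z ∈ goldens ⊎ oneᴿ ≤ᴿ distSq z w
gap z w z∈S w∈S w≢z = decided (oneᴿ ≤ᴿ? distSq z w)
  where
  bound = σ-difference-bound z w z∈S w∈S
  classify : Gap (w -ᴷ z) → w -ᴷ z ∈ goldens ⊎ oneᴿ ≤ᴿ distSq z w
  classify (inj₁ d≡0)                   = ⊥-elim (w≢z (w-ᴷz≡0ᴷ⇒w≡z d≡0))
  classify (inj₂ (inj₁ golden))         = inj₁ golden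
  classify (inj₂ (inj₂ (inj₁ far)))     = inj₂ far
  classify (inj₂ (inj₂ (inj₂ unbound))) = ⊥-elim (unbound bound)
  decided : Dec (oneᴿ ≤ᴿ distSq z w) → w -ᴷ z ∈ goldens ⊎ oneᴿ ≤ᴿ distSq z w
  decided (yes far)  = inj₂ far
  decided (no short) = classify (∈-box gap-on-box (w -ᴷ z) (trace-bound (w -ᴷ z) bound short))

distSq-+ᴷ : ∀ z g → distSq z (z +ᴷ g) ≡ absSq g
distSq-+ᴷ z g = cong absSq (z+ᴷg-ᴷz≡g z g)

+ᴷ-≢ : ∀ z g → absSq g ≢ 0ᴿ → z +ᴷ g ≢ z
+ᴷ-≢ z g |g|≢0 z+g≡z = |g|≢0 (trans (sym (distSq-+ᴷ z g)) (trans (cong (distSq z) z+g≡z) (cong absSq (z-ᴷz≡0ᴷ z))))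

golden-norms : All (λ g → absSq g ≡ goldSqᴿ) goldens
golden-norms = refl ∷ refl ∷ refl ∷ refl ∷ refl ∷ refl ∷ refl ∷ refl ∷ refl ∷ refl ∷ []

unit-norms : All (λ e → absSq e ≡ oneᴿ) units
unit-norms = refl ∷ refl ∷ refl ∷ refl ∷ refl ∷ refl ∷ refl ∷ refl ∷ refl ∷ refl ∷ []

goldSq≤one : goldSqᴿ ≤ᴿ oneᴿ
goldSq≤one = toWitness {a? = goldSqᴿ ≤ᴿ? oneᴿ} _

goldSq≤distSq : ∀ z w → InS z → InS w → w ≢ z → goldSqᴿ ≤ᴿ distSq z w
goldSq≤distSq z w z∈S w∈S w≢z =
  [ (λ w-z∈goldens → subst (goldSqᴿ ≤ᴿ_) (sym (lookup golden-norms w-z∈goldens)) (≤ᴿ-refl goldSqᴿ))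
  , ≤ᴿ-trans goldSqᴿ oneᴿ (distSq z w) goldSq≤one
  ]′ (gap z w z∈S w∈S w≢z)

one≤distSq : ∀ z w → InS z → ¬ Any (λ g → InS (z +ᴷ g)) goldens → InS w → w ≢ z → oneᴿ ≤ᴿ distSq z w
one≤distSq z w z∈S no-golden w∈S w≢z =
  [ (λ w-z∈goldens → ⊥-elim (no-golden (lose w-z∈goldens (subst InS (sym (z+ᴷ[w-ᴷz]≡w z w)) w∈S))))
  , id
  ]′ (gap z w z∈S w∈S w≢z)

NearestNeighbour : OK → OK → Set
NearestNeighbour z z' = InS z' × z' ≢ z
  × ((w : OK) → InS w → w ≢ z → distSq z z' ≤ᴿ distSq z w)
  × (distSq z z' ≡ goldSqᴿ ⊎ distSq z z' ≡ oneᴿ)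

nearest-at : ∀ z g r → InS (z +ᴷ g) → absSq g ≡ r → r ≢ 0ᴿ →
  ((w : OK) → InS w → w ≢ z → r ≤ᴿ distSq z w) → r ≡ goldSqᴿ ⊎ r ≡ oneᴿ → NearestNeighbour z (z +ᴷ g)
nearest-at z g r z+g∈S |g|≡r r≢0 minimal r≡ =
  z+g∈S , +ᴷ-≢ z g (λ |g|≡0 → r≢0 (trans (sym |g|≡r) |g|≡0)) ,
  (λ w w∈S w≢z → subst (_≤ᴿ distSq z w) (sym d≡r) (minimal w w∈S w≢z)) ,
  subst (λ s → s ≡ goldSqᴿ ⊎ s ≡ oneᴿ) (sym d≡r) r≡
  where
  d≡r = trans (distSq-+ᴷ z g) |g|≡r

theorem2p1 : (z : OK) → InS z →
    Σ OK (λ z' → InS z' × z' ≢ z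
      × ((w : OK) → InS w → w ≢ z → distSq z z' ≤ᴿ distSq z w)
      × (distSq z z' ≡ goldSqᴿ ⊎ distSq z z' ≡ oneᴿ))
theorem2p1 z z∈S = nearest (any? (λ g → InS? (z +ᴷ g)) goldens)
  where
  nearest : Dec (Any (λ g → InS (z +ᴷ g)) goldens) → Σ OK (NearestNeighbour z)
  nearest (yes golden) =
    let |g|≡φ , z+g∈S = lookupAny golden-norms golden
    in z +ᴷ Any.lookup golden ,
       nearest-at z (Any.lookup golden) goldSqᴿ z+g∈S |g|≡φ (λ ()) (λ w → goldSq≤distSq z w z∈S) (inj₁ refl)
  nearest (no none) =
    let unit = unit-neighbour z z∈S
        |e|≡1 , z+e∈S = lookupAny unit-norms unit
    in z +ᴷ Any.lookup unit ,
       nearest-at z (Any.lookup unit) oneᴿ z+e∈S |e|≡1 (λ ()) (λ w → one≤distSq z w z∈S none) (inj₂ refl)
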